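{- Let $p$ be a prime and let $R=R_1\times\cdots\times R_d$ where each $R_i$ is a finite commutative local ring, with $-1\in (R^{\times})^p$. Let $I=I_1\times\cdots\times I_d$ be a proper ideal of $R$ (each $I_i$ an ideal of $R_i$, $I\ne R$). Then $I$ is a homogeneous set in $G_R(p)$ if and only if (1) $I_i$ is a homogeneous set in $G_{R_i}(p)$ for each $1\le i\le d$, and (2) $I_i\neq R_i$ for each $1\le i\le d$.
   Context: For a finite commutative ring $S$, $(S^{\times})^p=\{u^p:u\in S^{\times}\}$; it is assumed throughout that $-1$ lies in it. $G_S(p)$ is the simple undirected graph with vertex set $S$ in which $a,b$ are adjacent iff $a-b\in (S^{\times})^p$. A homogeneous set in a graph $G$ is a set $X\subseteq V(G)$ such that every vertex of $V(G)\setminus X$ is adjacent to all or to none of the vertices of $X$. -}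

module Defs where

open import Level using (Level; _⊔_) renaming (suc to lsuc)
open import Data.Nat using (ℕ; zero; suc)
open import Data.Fin using (Fin)
open import Data.Product using (Σ; ∃; _×_; _,_; proj₁; proj₂)
open import Data.Sum using (_⊎_)
open import Relation.Nullary using (¬_)
open import Relation.Binary.Bundles using (Setoid)
open import Relation.Binary.Structures using (IsEquivalence)
import Relation.Binary.PropositionalEquality as ≡
open import Function.Bundles using (Inverse)
open import Algebra.Bundles using (CommutativeRing)
open import Algebra.Structures

module _ {c ℓ : Level} {d : ℕ} (Rs : Fin d → CommutativeRing c ℓ) where
  private
    module R (i : Fin d) = CommutativeRing (Rs i)

  ΠCarrier : Set c
  ΠCarrier = (i : Fin d) → R.Carrier i

  Π-isCommutativeRing :
    IsCommutativeRing {A = ΠCarrier} (λ x y → (i : Fin d) → R._≈_ i (x i) (y i))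
      (λ x y i → R._+_ i (x i) (y i)) (λ x y i → R._*_ i (x i) (y i))
      (λ x i → R.-_ i (x i)) (λ i → R.0# i) (λ i → R.1# i)
  Π-isCommutativeRing = record
    { isRing = record
      { +-isAbelianGroup = record
        { isGroup = record
          { isMonoid = record
            { isSemigroup = record
              { isMagma = record
                { isEquivalence = record
                  { refl = λ i → R.refl i
                  ; sym = λ p i → R.sym i (p i)
                  ; trans = λ p q i → R.trans i (p i) (q i) }
                ; ∙-cong = λ p q i → R.+-cong i (p i) (q i) }
              ; assoc = λ x y z i → R.+-assoc i (x i) (y i) (z i) }
            ; identity = (λ x i → proj₁ (R.+-identity i) (x i))
                       , (λ x i → proj₂ (R.+-identity i) (x i)) }
          ; inverse = (λ x i → proj₁ (R.-‿inverse i) (x i))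
                    , (λ x i → proj₂ (R.-‿inverse i) (x i))
          ; ⁻¹-cong = λ p i → R.-‿cong i (p i) }
        ; comm = λ x y i → R.+-comm i (x i) (y i) }
      ; *-cong = λ p q i → R.*-cong i (p i) (q i)
      ; *-assoc = λ x y z i → R.*-assoc i (x i) (y i) (z i)
      ; *-identity = (λ x i → proj₁ (R.*-identity i) (x i))
                   , (λ x i → proj₂ (R.*-identity i) (x i))
      ; distrib = (λ x y z i → proj₁ (R.distrib i) (x i) (y i) (z i))
                , (λ x y z i → proj₂ (R.distrib i) (x i) (y i) (z i)) }
    ; *-comm = λ x y i → R.*-comm i (x i) (y i) }

  ΠRing : CommutativeRing c ℓ
  ΠRing = record { isCommutativeRing = Π-isCommutativeRing }

module _ {c ℓ : Level} (R : CommutativeRing c ℓ) where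
  open CommutativeRing R

  pow : Carrier → ℕ → Carrier
  pow x zero    = 1#
  pow x (suc n) = x * pow x n

  Finite : Set (c ⊔ ℓ)
  Finite = Σ ℕ λ n → Inverse (≡.setoid (Fin n)) setoid

  IsUnit : Carrier → Set (c ⊔ ℓ)
  IsUnit u = Σ Carrier λ v → u * v ≈ 1#

  InUnitPowers : ℕ → Carrier → Set (c ⊔ ℓ)
  InUnitPowers p a = Σ Carrier λ u → IsUnit u × (pow u p ≈ a)

  record Ideal : Set (lsuc (c ⊔ ℓ)) where
    field
      _∈I       : Carrier → Set (c ⊔ ℓ)
      ∈-resp-≈  : ∀ {x y} → x ≈ y → x ∈I → y ∈I
      0∈        : 0# ∈I
      +-closed  : ∀ {x y} → x ∈I → y ∈I → (x + y) ∈I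
      neg-closed : ∀ {x} → x ∈I → (- x) ∈I
      *-closed  : ∀ r {x} → x ∈I → (r * x) ∈I

  open Ideal public

  Proper : Ideal → Set (c ⊔ ℓ)
  Proper I = ¬ (∀ x → _∈I I x)

  _⊆I_ : Ideal → Ideal → Set (c ⊔ ℓ)
  I ⊆I J = ∀ x → _∈I I x → _∈I J x

  IsMaximal : Ideal → Set (lsuc (c ⊔ ℓ))
  IsMaximal M = Proper M × (∀ (J : Ideal) → M ⊆I J → Proper J → J ⊆I M)

  IsLocal : Set (lsuc (c ⊔ ℓ))
  IsLocal = Σ Ideal λ M → IsMaximal M ×
              (∀ (N : Ideal) → IsMaximal N → (N ⊆I M × M ⊆I N))

  Adjacent : ℕ → Carrier → Carrier → Set (c ⊔ ℓ)
  Adjacent p a b = (¬ (a ≈ b)) × InUnitPowers p (a - b)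

  Homogeneous : ℕ → (Carrier → Set (c ⊔ ℓ)) → Set (c ⊔ ℓ)
  Homogeneous p X = ∀ v → ¬ X v →
      (∀ x → X x → Adjacent p v x) ⊎ (∀ x → X x → ¬ Adjacent p v x)

module _ {c ℓ : Level} {d : ℕ} (Rs : Fin d → CommutativeRing c ℓ) where
  private
    module R (i : Fin d) = CommutativeRing (Rs i)

  ΠIdeal : ((i : Fin d) → Ideal (Rs i)) → Ideal (ΠRing Rs)
  ΠIdeal Is = record
    { _∈I = λ x → (i : Fin d) → _∈I (Is i) (x i)
    ; ∈-resp-≈ = λ p h i → ∈-resp-≈ (Is i) (p i) (h i)
    ; 0∈ = λ i → 0∈ (Is i)
    ; +-closed = λ h k i → +-closed (Is i) (h i) (k i)
    ; neg-closed = λ h i → neg-closed (Is i) (h i)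
    ; *-closed = λ r h i → *-closed (Is i) (r i) (h i) }

{-# OPTIONS --safe #-}
-- For a proper ideal I, a vertex v ∉ I is adjacent to x ∈ I exactly when
-- v - x ∈ (R^×)^p, so I is homogeneous iff (R^×)^p is a union of cosets of I,
-- i.e. (R^×)^p + I ⊆ (R^×)^p.  In a product ring both (R^×)^p and I are
-- componentwise, hence so is this saturation condition; and a saturated I_i
-- is proper, since otherwise 1 + (-1) = 0 would be a unit.
module Submission where

open import Defs
open import Level using (Level; _⊔_)
open import Data.Nat using (ℕ; zero; suc)
open import Data.Nat.Primality using (Prime)
open import Data.Fin using (Fin)
open import Data.Fin.Properties using (_≟_; any?; all?; inj⇒≟)
open import Data.Product using (Σ; _×_; _,_; proj₁; proj₂)
open import Data.Sum using (inj₁; inj₂; [_,_])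
open import Data.Empty using (⊥-elim)
open import Relation.Nullary using (¬_; Dec; yes; no)
open import Relation.Nullary.Decidable using (_×-dec_; map′)
open import Relation.Binary.PropositionalEquality as ≡ using (_≡_)
open import Function.Bundles using (_⇔_; Inverse; mk⇔)
open import Function.Properties.Inverse using (Inverse⇒Injection)
import Function.Construct.Symmetry as Symmetry
open import Algebra.Bundles using (CommutativeRing)

module _ {c ℓ : Level} (R : CommutativeRing c ℓ) where
  open CommutativeRing R
  open import Algebra.Properties.Ring ring using (-0#≈0#; -‿involutive; //-rightDividesˡ)
  open import Algebra.Properties.CommutativeSemigroup *-commutativeSemigroup using (interchange)

  isUnit-resp-≈ : ∀ {u v} → u ≈ v → IsUnit R u → IsUnit R v
  isUnit-resp-≈ u≈v (w , uw≈1) = w , trans (*-congʳ (sym u≈v)) uw≈1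

  isUnit-* : ∀ {u v} → IsUnit R u → IsUnit R v → IsUnit R (u * v)
  isUnit-* {u} {v} (u⁻¹ , uu⁻¹≈1) (v⁻¹ , vv⁻¹≈1) = u⁻¹ * v⁻¹ , (begin
    (u * v) * (u⁻¹ * v⁻¹) ≈⟨ interchange u v u⁻¹ v⁻¹ ⟩
    (u * u⁻¹) * (v * v⁻¹) ≈⟨ *-cong uu⁻¹≈1 vv⁻¹≈1 ⟩
    1# * 1#               ≈⟨ *-identityˡ 1# ⟩
    1#                    ∎)
    where open import Relation.Binary.Reasoning.Setoid setoid

  isUnit-pow : ∀ {u} n → IsUnit R u → IsUnit R (pow R u n)
  isUnit-pow zero    _  = 1# , *-identityˡ 1#
  isUnit-pow (suc n) hu = isUnit-* hu (isUnit-pow n hu)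

  pow-cong : ∀ {x y} n → x ≈ y → pow R x n ≈ pow R y n
  pow-cong zero    _   = refl
  pow-cong (suc n) x≈y = *-cong x≈y (pow-cong n x≈y)

  pow-1# : ∀ n → pow R 1# n ≈ 1#
  pow-1# zero    = refl
  pow-1# (suc n) = trans (*-identityˡ _) (pow-1# n)

  local⇒1≉0 : IsLocal R → ¬ 1# ≈ 0#
  local⇒1≉0 (M , (M-proper , _) , _) 1≈0 = M-proper λ x →
    ∈-resp-≈ M (trans (trans (sym (zeroʳ x)) (*-congˡ (sym 1≈0))) (*-identityʳ x)) (0∈ M)

  module _ (I : Ideal R) where

    unit∉proper : Proper R I → ∀ {u} → IsUnit R u → ¬ _∈I I u
    unit∉proper I-proper {u} (w , uw≈1) u∈I = I-proper λ x →
      ∈-resp-≈ I (*-identityʳ x)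
        (*-closed I x (∈-resp-≈ I (trans (*-comm w u) uw≈1) (*-closed I w u∈I)))

    ∉⇒≉ : ∀ {v x} → ¬ _∈I I v → _∈I I x → ¬ v ≈ x
    ∉⇒≉ v∉I x∈I v≈x = v∉I (∈-resp-≈ I (sym v≈x) x∈I)

  module _ (p : ℕ) where

    1#∈UnitPowers : InUnitPowers R p 1#
    1#∈UnitPowers = 1# , (1# , *-identityˡ 1#) , pow-1# p

    inUnitPowers-resp-≈ : ∀ {a b} → a ≈ b → InUnitPowers R p a → InUnitPowers R p b
    inUnitPowers-resp-≈ a≈b (u , hu , uᵖ≈a) = u , hu , trans uᵖ≈a a≈b

    unitPower⇒isUnit : ∀ {a} → InUnitPowers R p a → IsUnit R a
    unitPower⇒isUnit (u , hu , uᵖ≈a) = isUnit-resp-≈ uᵖ≈a (isUnit-pow p hu)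

    UnitPowersSaturated : Ideal R → Set (c ⊔ ℓ)
    UnitPowersSaturated I =
      ∀ {a x} → _∈I I x → InUnitPowers R p a → InUnitPowers R p (a + x)

    module _ (I : Ideal R) where

      homogeneous⇒saturated : Proper R I → Homogeneous R p (_∈I I) → UnitPowersSaturated I
      homogeneous⇒saturated I-proper hom {a} {x} x∈I a∈Uᵖ =
        [ (λ adjacent-to-all → inUnitPowers-resp-≈ (+-congˡ (-‿involutive x))
                                 (proj₂ (adjacent-to-all (- x) (neg-closed I x∈I))))
        , (λ adjacent-to-none → ⊥-elim (adjacent-to-none 0# (0∈ I)
                                 (∉⇒≉ I a∉I (0∈ I) , inUnitPowers-resp-≈ a≈a-0 a∈Uᵖ)))
        ] (hom a a∉I)
        where
        a∉I : ¬ _∈I I a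
        a∉I = unit∉proper I I-proper (unitPower⇒isUnit a∈Uᵖ)
        a≈a-0 : a ≈ a - 0#
        a≈a-0 = sym (trans (+-congˡ -0#≈0#) (+-identityʳ a))

      saturated⇒homogeneous : (∀ a → Dec (InUnitPowers R p a)) →
        UnitPowersSaturated I → Homogeneous R p (_∈I I)
      saturated⇒homogeneous inUnitPowers? sat v v∉I with inUnitPowers? v
      ... | yes v∈Uᵖ = inj₁ λ x x∈I → ∉⇒≉ I v∉I x∈I , sat (neg-closed I x∈I) v∈Uᵖ
      ... | no  v∉Uᵖ = inj₂ λ x x∈I (_ , v-x∈Uᵖ) →
        v∉Uᵖ (inUnitPowers-resp-≈ (//-rightDividesˡ x v) (sat x∈I v-x∈Uᵖ))

      saturated⇒proper : ¬ 1# ≈ 0# → UnitPowersSaturated I → Proper R I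
      saturated⇒proper 1≉0 sat I≡R with
        unitPower⇒isUnit (inUnitPowers-resp-≈ (-‿inverseʳ 1#) (sat (I≡R (- 1#)) 1#∈UnitPowers))
      ... | w , 0w≈1 = 1≉0 (trans (sym 0w≈1) (zeroˡ w))

  module _ (finite : Finite R) where
    open Inverse (proj₂ finite) using (to; from; strictlyInverseˡ)

    _≈?_ : ∀ x y → Dec (x ≈ y)
    _≈?_ = inj⇒≟ (Inverse⇒Injection (Symmetry.inverse (proj₂ finite)))

    ∃? : ∀ {ℓ′} (P : Carrier → Set ℓ′) → (∀ {x y} → x ≈ y → P x → P y) →
      (∀ x → Dec (P x)) → Dec (Σ Carrier P)
    ∃? P P-resp-≈ P? = map′ (λ (i , Pi) → to i , Pi)
      (λ (x , Px) → from x , P-resp-≈ (sym (strictlyInverseˡ x)) Px)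
      (any? λ i → P? (to i))

    isUnit? : ∀ u → Dec (IsUnit R u)
    isUnit? u = ∃? (λ w → u * w ≈ 1#) (λ w≈w′ → trans (*-congˡ (sym w≈w′))) (λ w → (u * w) ≈? 1#)

    inUnitPowers? : ∀ p a → Dec (InUnitPowers R p a)
    inUnitPowers? p a = ∃? (λ u → IsUnit R u × pow R u p ≈ a)
      (λ u≈u′ (hu , uᵖ≈a) → isUnit-resp-≈ u≈u′ hu , trans (pow-cong p (sym u≈u′)) uᵖ≈a)
      (λ u → isUnit? u ×-dec (pow R u p ≈? a))

module _ {c ℓ : Level} {d : ℕ} (Rs : Fin d → CommutativeRing c ℓ) where
  private
    module R (i : Fin d) = CommutativeRing (Rs i)
    ΠR : CommutativeRing c ℓ
    ΠR = ΠRing Rs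

  pow-Π : ∀ (u : ΠCarrier Rs) n i → pow ΠR u n i ≡ pow (Rs i) (u i) n
  pow-Π u zero    i = ≡.refl
  pow-Π u (suc n) i = ≡.cong (R._*_ i (u i)) (pow-Π u n i)

  update : (i : Fin d) → R.Carrier i → ΠCarrier Rs → ΠCarrier Rs
  update i a f k with k ≟ i
  ... | yes ≡.refl = a
  ... | no  _      = f k

  update-same : ∀ i a f → update i a f i ≡ a
  update-same i a f with i ≟ i
  ... | yes ≡.refl = ≡.refl
  ... | no  i≢i    = ⊥-elim (i≢i ≡.refl)

  ∀-update : ∀ {ℓ′} (P : (k : Fin d) → R.Carrier k → Set ℓ′) {i a f} →
    P i a → (∀ k → P k (f k)) → ∀ k → P k (update i a f k)
  ∀-update P {i} Pa Pf k with k ≟ i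
  ... | yes ≡.refl = Pa
  ... | no  _      = Pf k

  module _ (p : ℕ) where

    inUnitPowers-Π⁻ : ∀ {a} → InUnitPowers ΠR p a → ∀ i → InUnitPowers (Rs i) p (a i)
    inUnitPowers-Π⁻ (u , (w , uw≈1) , uᵖ≈a) i =
      u i , (w i , uw≈1 i) , R.trans i (R.reflexive i (≡.sym (pow-Π u p i))) (uᵖ≈a i)

    inUnitPowers-Π⁺ : ∀ {a} → (∀ i → InUnitPowers (Rs i) p (a i)) → InUnitPowers ΠR p a
    inUnitPowers-Π⁺ h = u , (w , λ i → proj₂ (proj₁ (proj₂ (h i)))) ,
      λ i → R.trans i (R.reflexive i (pow-Π u p i)) (proj₂ (proj₂ (h i)))
      where
      u w : ΠCarrier Rs
      u i = proj₁ (h i)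
      w i = proj₁ (proj₁ (proj₂ (h i)))

    inUnitPowers-Π? : (∀ i a → Dec (InUnitPowers (Rs i) p a)) →
      ∀ a → Dec (InUnitPowers ΠR p a)
    inUnitPowers-Π? dec a = map′ inUnitPowers-Π⁺ inUnitPowers-Π⁻ (all? λ i → dec i (a i))

    module _ (Is : (i : Fin d) → Ideal (Rs i)) where

      saturated-Π⁺ : (∀ i → UnitPowersSaturated (Rs i) p (Is i)) →
        UnitPowersSaturated ΠR p (ΠIdeal Rs Is)
      saturated-Π⁺ sat x∈I a∈Uᵖ =
        inUnitPowers-Π⁺ λ i → sat i (x∈I i) (inUnitPowers-Π⁻ a∈Uᵖ i)

      saturated-Π⁻ : UnitPowersSaturated ΠR p (ΠIdeal Rs Is) →
        ∀ i → UnitPowersSaturated (Rs i) p (Is i)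
      saturated-Π⁻ sat i {a} {x} x∈Iᵢ a∈Uᵖ =
        ≡.subst₂ (λ b y → InUnitPowers (Rs i) p (R._+_ i b y))
          (update-same i a ones) (update-same i x zeros)
          (inUnitPowers-Π⁻ (sat x̂∈I â∈Uᵖ) i)
        where
        ones zeros : ΠCarrier Rs
        ones k  = R.1# k
        zeros k = R.0# k
        â∈Uᵖ : InUnitPowers ΠR p (update i a ones)
        â∈Uᵖ = inUnitPowers-Π⁺ (∀-update (λ k → InUnitPowers (Rs k) p) a∈Uᵖ
                 (λ k → 1#∈UnitPowers (Rs k) p))
        x̂∈I : _∈I (ΠIdeal Rs Is) (update i x zeros)
        x̂∈I = ∀-update (λ k → _∈I (Is k)) x∈Iᵢ (λ k → 0∈ (Is k))

lemma5p4 : {c ℓ : Level} (p : ℕ) → Prime p → (d : ℕ)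
    → (Rs : Fin d → CommutativeRing c ℓ)
    → ((i : Fin d) → Finite (Rs i))
    → ((i : Fin d) → IsLocal (Rs i))
    → InUnitPowers (ΠRing Rs) p (CommutativeRing.-_ (ΠRing Rs) (CommutativeRing.1# (ΠRing Rs)))
    → (Is : (i : Fin d) → Ideal (Rs i))
    → Proper (ΠRing Rs) (ΠIdeal Rs Is)
    → (Homogeneous (ΠRing Rs) p (_∈I (ΠIdeal Rs Is))
    ⇔ (((i : Fin d) → Homogeneous (Rs i) p (_∈I (Is i)))
    × ((i : Fin d) → Proper (Rs i) (Is i))))
lemma5p4 p _ d Rs finite local _ Is I-proper = mk⇔ components-homogeneous product-homogeneous
  where
  I : Ideal (ΠRing Rs)
  I = ΠIdeal Rs Is

  components-homogeneous : Homogeneous (ΠRing Rs) p (_∈I I) →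
    ((i : Fin d) → Homogeneous (Rs i) p (_∈I (Is i))) × ((i : Fin d) → Proper (Rs i) (Is i))
  components-homogeneous hom =
    (λ i → saturated⇒homogeneous (Rs i) p (Is i) (inUnitPowers? (Rs i) (finite i) p) (satᵢ i)) ,
    (λ i → saturated⇒proper (Rs i) p (Is i) (local⇒1≉0 (Rs i) (local i)) (satᵢ i))
    where
    satᵢ : ∀ i → UnitPowersSaturated (Rs i) p (Is i)
    satᵢ = saturated-Π⁻ Rs p Is (homogeneous⇒saturated (ΠRing Rs) p I I-proper hom)

  product-homogeneous : ((i : Fin d) → Homogeneous (Rs i) p (_∈I (Is i))) × ((i : Fin d) → Proper (Rs i) (Is i)) →
    Homogeneous (ΠRing Rs) p (_∈I I)
  product-homogeneous (homᵢ , properᵢ) =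
    saturated⇒homogeneous (ΠRing Rs) p I
      (inUnitPowers-Π? Rs p λ i → inUnitPowers? (Rs i) (finite i) p)
      (saturated-Π⁺ Rs p Is λ i → homogeneous⇒saturated (Rs i) p (Is i) (properᵢ i) (homᵢ i))
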